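{- Let $m\geq 3$ be an integer and let $M$ be an induced matching of the grid $G_{3,m}$. If the edge joining $u_1v_2$ and $u_2v_2$ belongs to $M$, then $|M|\neq \mathrm{Max}(G_{3,m})$.
   Context: For integers $n,m\geq 2$, the grid $G_{n,m}$ is the Cartesian product of the path $P_n=u_1u_2\cdots u_n$ and the path $P_m=v_1v_2\cdots v_m$; its vertices are written $u_iv_j$ ($1\le i\le n$, $1\le j\le m$), and $u_iv_j$, $u_kv_l$ are adjacent iff either $i=k$ and $|j-l|=1$, or $j=l$ and $|i-k|=1$. An induced matching of a graph $G$ is a set $M$ of pairwise vertex-disjoint edges such that no edge of $G$ joins endpoints of two distinct edges of $M$. $\mathrm{Max}(G)$ denotes the maximum size of an induced matching of $G$. -}

module Defs where

open import Data.Nat using (ℕ; suc; _≤_)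
open import Data.Fin using (Fin; toℕ; zero; suc)
open import Data.Product using (_×_; _,_; proj₁; proj₂)
open import Data.Sum using (_⊎_)
open import Data.List using (List; length; lookup)
open import Relation.Binary.PropositionalEquality using (_≡_; _≢_)
open import Relation.Nullary using (¬_)
open import Data.List.Membership.Propositional using (_∈_)

-- Vertices of the grid G_{n,m}: u_i v_j is represented by (i-1 , j-1).
Vertex : ℕ → ℕ → Set
Vertex n m = Fin n × Fin m

PathAdj : ℕ → ℕ → Set
PathAdj a b = suc a ≡ b ⊎ suc b ≡ a

GridAdj : ∀ {n m} → Vertex n m → Vertex n m → Set
GridAdj (i , j) (k , l) =
  (i ≡ k × PathAdj (toℕ j) (toℕ l)) ⊎ (j ≡ l × PathAdj (toℕ i) (toℕ k))

-- an edge of the grid: an (oriented representative of an) adjacent pair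
Edge : ℕ → ℕ → Set
Edge n m = Vertex n m × Vertex n m

IsEdge : ∀ {n m} → Edge n m → Set
IsEdge (x , y) = GridAdj x y

_∈ₑ_ : ∀ {n m} → Vertex n m → Edge n m → Set
x ∈ₑ e = x ≡ proj₁ e ⊎ x ≡ proj₂ e

Touch : ∀ {n m} → Edge n m → Edge n m → Set
Touch e f = (proj₁ e ∈ₑ f) ⊎ (proj₂ e ∈ₑ f)

Joined : ∀ {n m} → Edge n m → Edge n m → Set
Joined e f = (GridAdj (proj₁ e) (proj₁ f) ⊎ GridAdj (proj₁ e) (proj₂ f))
           ⊎ (GridAdj (proj₂ e) (proj₁ f) ⊎ GridAdj (proj₂ e) (proj₂ f))

-- An induced matching of G_{n,m}, given as a list of its edges (each listed once):
-- every entry is a grid edge, and any two entries at distinct positions are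
-- vertex-disjoint and not joined by an edge of the grid.
-- (Vertex-disjointness of distinct positions also forces the list to have no
-- repeated edges, so length = number of edges |M|.)
IsInducedMatching : ∀ n m → List (Edge n m) → Set
IsInducedMatching n m M =
  (∀ p → IsEdge (lookup M p)) ×
  (∀ p q → p ≢ q → ¬ Touch (lookup M p) (lookup M q) × ¬ Joined (lookup M p) (lookup M q))

IsMaximumInducedMatching : ∀ n m → List (Edge n m) → Set
IsMaximumInducedMatching n m M =
  IsInducedMatching n m M ×
  (∀ (N : List (Edge n m)) → IsInducedMatching n m N → length N ≤ length M)

u1v2 u2v2 : ∀ {m} → Vertex 3 (suc (suc m))
u1v2 = zero , suc zero
u2v2 = suc zero , suc zero

ContainsEdge : ∀ {n m} → List (Edge n m) → Vertex n m → Vertex n m → Set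
ContainsEdge {n} {m} M x y =
  (x , y) ∈ M ⊎ (y , x) ∈ M

module Submission where

-- Every edge of G_{3,m} has a slot: its kind (horizontal in one of the three rows, or vertical
-- between rows 1,2 or 2,3) and the column where it starts. In an induced matching the slots
-- starting in one column form one of seven patterns, and slots in columns at distance one or
-- two constrain each other. A potential ψ on pairs of consecutive column patterns satisfies
-- 4·|P_{j+2}| + ψ(P_{j+1}, P_{j+2}) ≤ 3 + ψ(P_j, P_{j+1}), a finite check; telescoping over
-- the columns, with the boundary terms controlled by the vertical edge u₁v₂u₂v₂ in column 2
-- and by the absence of horizontal edges starting in the last column, gives 4|M| ≤ 3m − 2.
-- Repeating three edges in every four columns gives an induced matching N with
-- 3m − 1 ≤ 4|N|, so M is not maximum.

open import Defs
open import Data.Nat using (ℕ; zero; suc; _+_; _*_; _⊓_; _≤_; _<_; _≟_; _≤?_; z≤n; s≤s)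
open import Data.Nat.Properties
  using ( ≤-pred; n≤1+n; m≤n⇒m⊓n≡m; m≥n⇒m⊓n≡n; ⊓-idem; m⊓n≤m; ≤-<-trans; ≤-reflexive
        ; n≮n; <-irrefl; ≤ᵇ⇒≤; +-assoc; *-zeroʳ; *-distribˡ-+
        ; +-cancelˡ-≡; +-cancelʳ-≡; +-cancelʳ-≤; +-mono-≤; +-monoˡ-≤; +-monoʳ-≤; *-monoʳ-≤
        ; +-commutativeSemigroup; module ≤-Reasoning)
open import Data.Nat.Solver using (module +-*-Solver)
open import Algebra.Properties.CommutativeSemigroup +-commutativeSemigroup using (x∙yz≈y∙xz)
open import Data.Fin as Fin using (Fin; toℕ; zero; suc; _↑ʳ_; _↑ˡ_; inject₁)
open import Data.Fin.Patterns using (0F; 1F; 2F; 3F; 4F)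
open import Data.Fin.Properties
  using (toℕ-injective; toℕ<n; ↑ʳ-injective) renaming (suc-injective to Fin-suc-injective)
open import Data.Product using (_×_; _,_; proj₁; proj₂; swap)
open import Data.Product.Properties using (≡-dec)
open import Data.Sum as Sum using (_⊎_; inj₁; inj₂; [_,_])
open import Data.List
  using (List; []; _∷_; _++_; map; lookup; length; filter; concat; applyUpTo; allFin)
open import Data.List.Properties using (length-++; length-++-sucʳ; length-map; filter-++)
open import Data.List.Relation.Unary.Unique.Propositional using (Unique)
open import Data.List.Relation.Unary.All as All using (All; []; _∷_; all?)
import Data.List.Relation.Unary.All.Properties as All
open import Data.List.Relation.Unary.Any as Any using (Any; here; there; any?)
open import Data.List.Relation.Unary.AllPairs as AllPairs using (AllPairs; []; _∷_; allPairs?)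
import Data.List.Relation.Unary.AllPairs.Properties as AllPairs
open import Data.List.Relation.Binary.Subset.Propositional using (_⊆_)
open import Data.List.Membership.Propositional using (_∈_; find)
open import Data.List.Membership.Propositional.Properties
  using ( ∈-lookup; ∈-∃++; ∈-++⁻; ∈-++⁺ˡ; ∈-++⁺ʳ; ∈-map⁺; ∈-map⁻; ∈-filter⁺; ∈-filter⁻
        ; ∈-concat⁺′; ∈-applyUpTo⁺; ∈-allFin)
open import Data.List.Relation.Unary.Any.Properties using (lookup-index; map⁺)
open import Relation.Binary.PropositionalEquality
  using (_≡_; _≢_; refl; sym; trans; cong; cong₂; subst; subst₂; module ≡-Reasoning)
open import Relation.Binary.Definitions using (DecidableEquality; Symmetric)
open import Relation.Nullary
  using (¬_; Dec; does; ¬?; _×-dec_; _⊎-dec_; _→-dec_; toWitness; contradiction)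
open import Data.Bool using (true; false)
open import Data.Unit using (tt)
open import Relation.Unary using (Decidable)
open import Function using (_∘_)

GridAdj-sym : ∀ {n m} {x y : Vertex n m} → GridAdj x y → GridAdj y x
GridAdj-sym (inj₁ (p , q)) = inj₁ (sym p , Sum.swap q)
GridAdj-sym (inj₂ (p , q)) = inj₂ (sym p , Sum.swap q)

Separated : ∀ {n m} → Edge n m → Edge n m → Set
Separated e f = ¬ Touch e f × ¬ Joined e f

Touch-sym : ∀ {n m} {e f : Edge n m} → Touch e f → Touch f e
Touch-sym (inj₁ (inj₁ p)) = inj₁ (inj₁ (sym p))
Touch-sym (inj₁ (inj₂ p)) = inj₂ (inj₁ (sym p))
Touch-sym (inj₂ (inj₁ p)) = inj₁ (inj₂ (sym p))
Touch-sym (inj₂ (inj₂ p)) = inj₂ (inj₂ (sym p))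

Joined-sym : ∀ {n m} {e f : Edge n m} → Joined e f → Joined f e
Joined-sym (inj₁ (inj₁ p)) = inj₁ (inj₁ (GridAdj-sym p))
Joined-sym (inj₁ (inj₂ p)) = inj₂ (inj₁ (GridAdj-sym p))
Joined-sym (inj₂ (inj₁ p)) = inj₁ (inj₂ (GridAdj-sym p))
Joined-sym (inj₂ (inj₂ p)) = inj₂ (inj₂ (GridAdj-sym p))

Separated-sym : ∀ {n m} → Symmetric (Separated {n} {m})
Separated-sym (¬touch , ¬joined) = ¬touch ∘ Touch-sym , ¬joined ∘ Joined-sym

PathAdj? : (a b : ℕ) → Dec (PathAdj a b)
PathAdj? a b = (suc a ≟ b) ⊎-dec (suc b ≟ a)

GridAdj? : ∀ {n m} (x y : Vertex n m) → Dec (GridAdj x y)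
GridAdj? (i , j) (k , l) =
  (i Fin.≟ k ×-dec PathAdj? (toℕ j) (toℕ l)) ⊎-dec (j Fin.≟ l ×-dec PathAdj? (toℕ i) (toℕ k))

_≟ᵥ_ : ∀ {n m} → DecidableEquality (Vertex n m)
_≟ᵥ_ = ≡-dec Fin._≟_ Fin._≟_

Separated? : ∀ {n m} (e f : Edge n m) → Dec (Separated e f)
Separated? (x , y) (u , v) =
  ¬? (((x ≟ᵥ u) ⊎-dec (x ≟ᵥ v)) ⊎-dec ((y ≟ᵥ u) ⊎-dec (y ≟ᵥ v))) ×-dec
  ¬? ((GridAdj? x u ⊎-dec GridAdj? x v) ⊎-dec (GridAdj? y u ⊎-dec GridAdj? y v))

module _ {A : Set} where

  All-lookup⁻ : ∀ {P : A → Set} xs → (∀ i → P (lookup xs i)) → All P xs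
  All-lookup⁻ {P} xs P-at =
    All.tabulate λ x∈xs → subst P (sym (lookup-index x∈xs)) (P-at (Any.index x∈xs))

  AllPairs-lookup⁻ : ∀ {R : A → A → Set} xs →
    (∀ i j → i ≢ j → R (lookup xs i) (lookup xs j)) → AllPairs R xs
  AllPairs-lookup⁻ []       R-at = []
  AllPairs-lookup⁻ (x ∷ xs) R-at =
    All-lookup⁻ xs (λ j → R-at zero (suc j) λ ()) ∷
    AllPairs-lookup⁻ xs (λ i j i≢j → R-at (suc i) (suc j) (i≢j ∘ Fin-suc-injective))

  AllPairs-lookup⁺ : ∀ {R : A → A → Set} {xs} → Symmetric R → AllPairs R xs →
    ∀ i j → i ≢ j → R (lookup xs i) (lookup xs j)
  AllPairs-lookup⁺ R-sym (Rx ∷ _)   zero    zero    i≢j = contradiction refl i≢j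
  AllPairs-lookup⁺ R-sym (Rx ∷ _)   zero    (suc j) _   = All.lookup Rx (∈-lookup j)
  AllPairs-lookup⁺ R-sym (Rx ∷ _)   (suc i) zero    _   = R-sym (All.lookup Rx (∈-lookup i))
  AllPairs-lookup⁺ R-sym (_ ∷ Rxs) (suc i) (suc j) i≢j =
    AllPairs-lookup⁺ R-sym Rxs i j (i≢j ∘ cong suc)

  AllPairs-∈ : ∀ {R : A → A → Set} {xs x y} → Symmetric R → AllPairs R xs →
    x ∈ xs → y ∈ xs → x ≡ y ⊎ R x y
  AllPairs-∈ R-sym (Rx ∷ _)   (here refl) (here refl) = inj₁ refl
  AllPairs-∈ R-sym (Rx ∷ _)   (here refl) (there y∈) = inj₂ (All.lookup Rx y∈)
  AllPairs-∈ R-sym (Rx ∷ _)   (there x∈) (here refl) = inj₂ (R-sym (All.lookup Rx x∈))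
  AllPairs-∈ R-sym (_ ∷ Rxs) (there x∈) (there y∈)  = AllPairs-∈ R-sym Rxs x∈ y∈

  AllPairs-mapᴬ : ∀ {P : A → Set} {R S : A → A → Set} {xs} →
    (∀ {x y} → P x → P y → R x y → S x y) → All P xs → AllPairs R xs → AllPairs S xs
  AllPairs-mapᴬ R⇒S []         []         = []
  AllPairs-mapᴬ R⇒S (px ∷ pxs) (Rx ∷ Rxs) =
    All.zipWith (λ (py , Rxy) → R⇒S px py Rxy) (pxs , Rx) ∷ AllPairs-mapᴬ R⇒S pxs Rxs

induced⇒AllPairs : ∀ {n m M} → IsInducedMatching n m M → All IsEdge M × AllPairs Separated M
induced⇒AllPairs {M = M} (isEdge , separated) =
  All-lookup⁻ M isEdge , AllPairs-lookup⁻ M separated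

AllPairs⇒induced : ∀ {n m M} → All IsEdge M → AllPairs Separated M → IsInducedMatching n m M
AllPairs⇒induced edges separated =
  (λ i → All.lookup edges (∈-lookup i)) , AllPairs-lookup⁺ Separated-sym separated

Point : Set
Point = ℕ × ℕ

point : ∀ {n m} → Vertex n m → Point
point (i , j) = toℕ i , toℕ j

Adjacent : Point → Point → Set
Adjacent (a , b) (c , d) = (a ≡ c × PathAdj b d) ⊎ (b ≡ d × PathAdj a c)

Near : Point → Point → Set
Near x y = x ≡ y ⊎ Adjacent x y

Near? : (x y : Point) → Dec (Near x y)
Near? (a , b) (c , d) =
  ≡-dec _≟_ _≟_ (a , b) (c , d) ⊎-dec
  ((a ≟ c ×-dec PathAdj? b d) ⊎-dec (b ≟ d ×-dec PathAdj? a c))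

Near-point⇒ : ∀ {n m} {u v : Vertex n m} → Near (point u) (point v) → u ≡ v ⊎ GridAdj u v
Near-point⇒ (inj₁ eq) =
  inj₁ (cong₂ _,_ (toℕ-injective (cong proj₁ eq)) (toℕ-injective (cong proj₂ eq)))
Near-point⇒ (inj₂ (inj₁ (p , q))) = inj₂ (inj₁ (toℕ-injective p , q))
Near-point⇒ (inj₂ (inj₂ (p , q))) = inj₂ (inj₂ (toℕ-injective p , q))

shiftʳ : ℕ → Point → Point
shiftʳ j (a , b) = a , b + j

Near-shiftʳ : ∀ j {x y} → Near x y → Near (shiftʳ j x) (shiftʳ j y)
Near-shiftʳ j (inj₁ refl) = inj₁ refl
Near-shiftʳ j (inj₂ (inj₁ (p , q))) = inj₂ (inj₁ (p , Sum.map (cong (_+ j)) (cong (_+ j)) q))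
Near-shiftʳ j (inj₂ (inj₂ (p , q))) = inj₂ (inj₂ (cong (_+ j) p , q))

Meet : List Point → List Point → Set
Meet xs ys = Any (λ x → Any (Near x) ys) xs

Meet? : (xs ys : List Point) → Dec (Meet xs ys)
Meet? xs ys = any? (λ x → any? (Near? x) ys) xs

Meet-shiftʳ : ∀ j {xs ys} → Meet xs ys → Meet (map (shiftʳ j) xs) (map (shiftʳ j) ys)
Meet-shiftʳ j = map⁺ ∘ Any.map (map⁺ ∘ Any.map (Near-shiftʳ j))

Kind : Set
Kind = Fin 5

pattern hor₀ = 0F
pattern hor₁ = 1F
pattern hor₂ = 2F
pattern ver₀ = 3F
pattern ver₁ = 4F

Slot : Set
Slot = Kind × ℕ

ends : Slot → List Point
ends (hor₀ , c) = (0 , c) ∷ (0 , suc c) ∷ []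
ends (hor₁ , c) = (1 , c) ∷ (1 , suc c) ∷ []
ends (hor₂ , c) = (2 , c) ∷ (2 , suc c) ∷ []
ends (ver₀ , c) = (0 , c) ∷ (1 , c) ∷ []
ends (ver₁ , c) = (1 , c) ∷ (2 , c) ∷ []

ends-shiftʳ : ∀ k c j → ends (k , c + j) ≡ map (shiftʳ j) (ends (k , c))
ends-shiftʳ hor₀ c j = refl
ends-shiftʳ hor₁ c j = refl
ends-shiftʳ hor₂ c j = refl
ends-shiftʳ ver₀ c j = refl
ends-shiftʳ ver₁ c j = refl

Clash : Slot → Slot → Set
Clash s t = Meet (ends s) (ends t)

Clash? : (s t : Slot) → Dec (Clash s t)
Clash? s t = Meet? (ends s) (ends t)

Clash-refl : ∀ s → Clash s s
Clash-refl (hor₀ , c) = here (here (inj₁ refl))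
Clash-refl (hor₁ , c) = here (here (inj₁ refl))
Clash-refl (hor₂ , c) = here (here (inj₁ refl))
Clash-refl (ver₀ , c) = here (here (inj₁ refl))
Clash-refl (ver₁ , c) = here (here (inj₁ refl))

Clash-shiftʳ : ∀ j {k l c d} → Clash (k , c) (l , d) → Clash (k , c + j) (l , d + j)
Clash-shiftʳ j {k} {l} {c} {d} clash =
  subst₂ Meet (sym (ends-shiftʳ k c j)) (sym (ends-shiftʳ l d j)) (Meet-shiftʳ j clash)

-- The last clause is never reached by the rows of an edge of G_{3,m}.
kindOf : ℕ → ℕ → Kind
kindOf 0 0 = hor₀
kindOf 1 1 = hor₁
kindOf 2 2 = hor₂
kindOf 0 1 = ver₀
kindOf 1 0 = ver₀
kindOf 1 2 = ver₁
kindOf 2 1 = ver₁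
kindOf _ _ = hor₀

slot : ∀ {m} → Edge 3 m → Slot
slot ((i , j) , (k , l)) = kindOf (toℕ i) (toℕ k) , toℕ j ⊓ toℕ l

points : ∀ {n m} → Edge n m → List Point
points (u , v) = point u ∷ point v ∷ []

horizontal-ends : ∀ a c → a < 3 → ends (kindOf a a , c) ≡ (a , c) ∷ (a , suc c) ∷ []
horizontal-ends 0 c _ = refl
horizontal-ends 1 c _ = refl
horizontal-ends 2 c _ = refl
horizontal-ends (suc (suc (suc a))) c (s≤s (s≤s (s≤s ())))

vertical-ends : ∀ a c → a < 2 →
  ends (kindOf a (suc a) , c) ≡ (a , c) ∷ (suc a , c) ∷ [] ×
  ends (kindOf (suc a) a , c) ≡ (a , c) ∷ (suc a , c) ∷ []
vertical-ends 0 c _ = refl , refl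
vertical-ends 1 c _ = refl , refl
vertical-ends (suc (suc a)) c (s≤s (s≤s ()))

slot-ends : ∀ {m} (e : Edge 3 m) → IsEdge e →
  ends (slot e) ≡ points e ⊎ ends (slot e) ≡ points (swap e)
slot-ends ((i , j) , (.i , l)) (inj₁ (refl , inj₁ q))
  rewrite sym q | m≤n⇒m⊓n≡m (n≤1+n (toℕ j)) = inj₁ (horizontal-ends (toℕ i) (toℕ j) (toℕ<n i))
slot-ends ((i , j) , (.i , l)) (inj₁ (refl , inj₂ q))
  rewrite sym q | m≥n⇒m⊓n≡n (n≤1+n (toℕ l)) = inj₂ (horizontal-ends (toℕ i) (toℕ l) (toℕ<n i))
slot-ends ((i , j) , (k , .j)) (inj₂ (refl , inj₁ q))
  rewrite sym q | ⊓-idem (toℕ j) =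
  inj₁ (proj₁ (vertical-ends (toℕ i) (toℕ j) (≤-pred (subst (_< 3) (sym q) (toℕ<n k)))))
slot-ends ((i , j) , (k , .j)) (inj₂ (refl , inj₂ q))
  rewrite sym q | ⊓-idem (toℕ j) =
  inj₂ (proj₂ (vertical-ends (toℕ k) (toℕ j) (≤-pred (subst (_< 3) (sym q) (toℕ<n i)))))

ends-slot⊆points : ∀ {m} {e : Edge 3 m} → IsEdge e → ends (slot e) ⊆ points e
ends-slot⊆points {e = e} isEdge x∈ with ends (slot e) | slot-ends e isEdge
... | _ | inj₁ refl = x∈
... | _ | inj₂ refl = swap-∈ x∈
  where
  swap-∈ : ∀ {x} → x ∈ points (swap e) → x ∈ points e
  swap-∈ (here x≡v)         = there (here x≡v)
  swap-∈ (there (here x≡u)) = here x≡u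

Near-points⇒¬Separated : ∀ {n m} {e f : Edge n m} {x y} →
  x ∈ points e → y ∈ points f → Near x y → ¬ Separated e f
Near-points⇒¬Separated (here refl) (here refl) near (¬touch , ¬joined) =
  [ ¬touch ∘ inj₁ ∘ inj₁ , ¬joined ∘ inj₁ ∘ inj₁ ] (Near-point⇒ near)
Near-points⇒¬Separated (here refl) (there (here refl)) near (¬touch , ¬joined) =
  [ ¬touch ∘ inj₁ ∘ inj₂ , ¬joined ∘ inj₁ ∘ inj₂ ] (Near-point⇒ near)
Near-points⇒¬Separated (there (here refl)) (here refl) near (¬touch , ¬joined) =
  [ ¬touch ∘ inj₂ ∘ inj₁ , ¬joined ∘ inj₂ ∘ inj₁ ] (Near-point⇒ near)
Near-points⇒¬Separated (there (here refl)) (there (here refl)) near (¬touch , ¬joined) =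
  [ ¬touch ∘ inj₂ ∘ inj₂ , ¬joined ∘ inj₂ ∘ inj₂ ] (Near-point⇒ near)

Clash⇒¬Separated : ∀ {m} {e f : Edge 3 m} → IsEdge e → IsEdge f →
  Clash (slot e) (slot f) → ¬ Separated e f
Clash⇒¬Separated isEdge-e isEdge-f clash =
  let x , x∈ , meets = find clash
      y , y∈ , near  = find meets
  in Near-points⇒¬Separated (ends-slot⊆points isEdge-e x∈) (ends-slot⊆points isEdge-f y∈) near

Unique-⊆⇒length≤ : ∀ {A : Set} {xs ys : List A} → Unique xs → xs ⊆ ys → length xs ≤ length ys
Unique-⊆⇒length≤ {xs = []}     _                _     = z≤n
Unique-⊆⇒length≤ {xs = x ∷ xs} (x∉xs ∷ unique) xs⊆ys with ∈-∃++ (xs⊆ys (here refl))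
... | ys₁ , ys₂ , refl =
  subst (suc (length xs) ≤_) (sym (length-++-sucʳ ys₁ x ys₂))
        (s≤s (Unique-⊆⇒length≤ unique xs⊆ys₁++ys₂))
  where
  xs⊆ys₁++ys₂ : xs ⊆ ys₁ ++ ys₂
  xs⊆ys₁++ys₂ z∈xs with ∈-++⁻ ys₁ (xs⊆ys (there z∈xs))
  ... | inj₁ z∈ys₁          = ∈-++⁺ˡ z∈ys₁
  ... | inj₂ (here refl)    = contradiction refl (All.lookup x∉xs z∈xs)
  ... | inj₂ (there z∈ys₂) = ∈-++⁺ʳ ys₁ z∈ys₂

∑< : ℕ → (ℕ → ℕ) → ℕ
∑< zero    f = 0
∑< (suc n) f = f 0 + ∑< n (f ∘ suc)

filter-map : ∀ {A B : Set} {P : B → Set} (P? : Decidable P) (f : A → B) xs →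
  filter P? (map f xs) ≡ map f (filter (P? ∘ f) xs)
filter-map P? f []       = refl
filter-map P? f (x ∷ xs) with does (P? (f x))
... | true  = cong (f x ∷_) (filter-map P? f xs)
... | false = filter-map P? f xs

∑<-cong : ∀ {f g : ℕ → ℕ} n → (∀ i → f i ≡ g i) → ∑< n f ≡ ∑< n g
∑<-cong zero    f≗g = refl
∑<-cong (suc n) f≗g = cong₂ _+_ (f≗g 0) (∑<-cong n (f≗g ∘ suc))

length-filter-concat : ∀ {A : Set} {P : A → Set} (P? : Decidable P) (f : ℕ → List A) n →
  length (filter P? (concat (applyUpTo f n))) ≡ ∑< n (length ∘ filter P? ∘ f)
length-filter-concat P? f zero    = refl
length-filter-concat P? f (suc n) = begin
  length (filter P? (f 0 ++ concat (applyUpTo (f ∘ suc) n)))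
    ≡⟨ cong length (filter-++ P? (f 0) _) ⟩
  length (filter P? (f 0) ++ filter P? (concat (applyUpTo (f ∘ suc) n)))
    ≡⟨ length-++ (filter P? (f 0)) ⟩
  length (filter P? (f 0)) + length (filter P? (concat (applyUpTo (f ∘ suc) n)))
    ≡⟨ cong (length (filter P? (f 0)) +_) (length-filter-concat P? (f ∘ suc) n) ⟩
  ∑< (suc n) (length ∘ filter P? ∘ f) ∎
  where open ≡-Reasoning

telescope : ∀ {a b} (w Φ : ℕ → ℕ) → (∀ i → a * w i + Φ (suc i) ≤ b + Φ i) →
  ∀ n → a * ∑< n w + Φ n ≤ n * b + Φ 0
telescope {a} w Φ step zero    = ≤-reflexive (cong (_+ Φ 0) (*-zeroʳ a))
telescope {a} {b} w Φ step (suc n) = begin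
  a * (w 0 + ∑< n (w ∘ suc)) + Φ (suc n)
    ≡⟨ cong (_+ Φ (suc n)) (*-distribˡ-+ a (w 0) _) ⟩
  (a * w 0 + a * ∑< n (w ∘ suc)) + Φ (suc n)
    ≡⟨ +-assoc (a * w 0) _ _ ⟩
  a * w 0 + (a * ∑< n (w ∘ suc) + Φ (suc n))
    ≤⟨ +-monoʳ-≤ (a * w 0) (telescope {a} {b} (w ∘ suc) (Φ ∘ suc) (step ∘ suc) n) ⟩
  a * w 0 + (n * b + Φ 1)
    ≡⟨ x∙yz≈y∙xz (a * w 0) (n * b) (Φ 1) ⟩
  n * b + (a * w 0 + Φ 1)
    ≤⟨ +-monoʳ-≤ (n * b) (step 0) ⟩
  n * b + (b + Φ 0)
    ≡⟨ x∙yz≈y∙xz (n * b) b (Φ 0) ⟩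
  b + (n * b + Φ 0)
    ≡⟨ +-assoc b (n * b) (Φ 0) ⟨
  suc n * b + Φ 0 ∎
  where open ≤-Reasoning

kinds : List Kind
kinds = allFin 5

Pattern : Set
Pattern = List Kind

subsequences : ∀ {A : Set} → List A → List (List A)
subsequences []       = [] ∷ []
subsequences (x ∷ xs) = map (x ∷_) (subsequences xs) ++ subsequences xs

filter∈subsequences : ∀ {A : Set} {P : A → Set} (P? : Decidable P) xs →
  filter P? xs ∈ subsequences xs
filter∈subsequences P? []       = here refl
filter∈subsequences P? (x ∷ xs) with does (P? x)
... | true  = ∈-++⁺ˡ (∈-map⁺ (x ∷_) (filter∈subsequences P? xs))
... | false = ∈-++⁺ʳ _ (filter∈subsequences P? xs)

Compatible : ℕ → Kind → Kind → Set
Compatible d k l = Clash (k , 0) (l , d) → d ≡ 0 × k ≡ l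

Compatible? : ∀ d k l → Dec (Compatible d k l)
Compatible? d k l = Clash? (k , 0) (l , d) →-dec (d ≟ 0 ×-dec k Fin.≟ l)

Consistent : ℕ → Pattern → Pattern → Set
Consistent d p q = All (λ k → All (Compatible d k) q) p

Consistent? : ∀ d p q → Dec (Consistent d p q)
Consistent? d p q = all? (λ k → all? (Compatible? d k) q) p

-- These are the seven lists [], [k] and [hor₀, hor₂].
feasible : List Pattern
feasible = filter (λ p → Consistent? 0 p p) (subsequences kinds)

-- Only the values on consistent pairs of patterns matter; they solve the linear inequalities
-- checked in potential-step, potential-start and potential-end.
potential : Pattern → Pattern → ℕ
potential []                 []                 = 6
potential []                 (hor₀ ∷ hor₂ ∷ []) = 0
potential []                 (_ ∷ [])           = 2
potential (hor₀ ∷ [])        []                 = 3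
potential (hor₀ ∷ [])        (hor₂ ∷ [])        = 0
potential (hor₁ ∷ [])        []                 = 5
potential (hor₂ ∷ [])        []                 = 3
potential (hor₂ ∷ [])        (hor₀ ∷ [])        = 0
potential (hor₀ ∷ hor₂ ∷ []) []                 = 3
potential (ver₀ ∷ [])        []                 = 5
potential (ver₀ ∷ [])        (hor₂ ∷ [])        = 1
potential (ver₁ ∷ [])        []                 = 5
potential (ver₁ ∷ [])        (hor₀ ∷ [])        = 1
potential _                  _                  = 0

PotentialStep : Pattern → Pattern → Pattern → Set
PotentialStep p q r = Consistent 1 p q → Consistent 1 q r → Consistent 2 p r →
  4 * length r + potential q r ≤ 3 + potential p q

potential-step : ∀ {p q r} → p ∈ feasible → q ∈ feasible → r ∈ feasible → PotentialStep p q r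
potential-step p∈ q∈ r∈ = All.lookup (All.lookup (All.lookup table p∈) q∈) r∈
  where
  table : All (λ p → All (λ q → All (PotentialStep p q) feasible) feasible) feasible
  table = toWitness {a? = all? (λ p → all? (λ q → all? (λ r →
    Consistent? 1 p q →-dec Consistent? 1 q r →-dec Consistent? 2 p r →-dec _ ≤? _)
    feasible) feasible) feasible} tt

Vertical : Kind → Set
Vertical k = k ≡ ver₀ ⊎ k ≡ ver₁

PotentialStart : Pattern → Pattern → Set
PotentialStart p q = ver₀ ∈ q → Consistent 1 p q → 4 * (length p + length q) + potential p q ≤ 6

potential-start : ∀ {p q} → p ∈ feasible → q ∈ feasible → PotentialStart p q
potential-start p∈ q∈ = All.lookup (All.lookup table p∈) q∈
  where
  table : All (λ p → All (PotentialStart p) feasible) feasible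
  table = toWitness {a? = all? (λ p → all? (λ q →
    any? (ver₀ Fin.≟_) q →-dec Consistent? 1 p q →-dec _ ≤? _) feasible) feasible} tt

PotentialEnd : Pattern → Pattern → Set
PotentialEnd p q = All Vertical q → Consistent 1 p q → 2 ≤ potential p q

potential-end : ∀ {p q} → p ∈ feasible → q ∈ feasible → PotentialEnd p q
potential-end p∈ q∈ = All.lookup (All.lookup table p∈) q∈
  where
  table : All (λ p → All (PotentialEnd p) feasible) feasible
  table = toWitness {a? = all? (λ p → all? (λ q →
    all? (λ k → (k Fin.≟ ver₀) ⊎-dec (k Fin.≟ ver₁)) q →-dec Consistent? 1 p q →-dec _ ≤? _)
    feasible) feasible} tt

-- The upper bound

_≟ₛ_ : DecidableEquality Slot
_≟ₛ_ = ≡-dec Fin._≟_ _≟_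

column : ℕ → List Slot
column c = map (_, c) kinds

slot-column< : ∀ {m} (e : Edge 3 m) → proj₂ (slot e) < m
slot-column< ((i , j) , (k , l)) = ≤-<-trans (m⊓n≤m (toℕ j) (toℕ l)) (toℕ<n j)

points-column< : ∀ {n m} (e : Edge n m) → All (λ x → proj₂ x < m) (points e)
points-column< ((i , j) , (k , l)) = toℕ<n j ∷ toℕ<n l ∷ []

ends-within⇒Vertical : ∀ k c → All (λ x → proj₂ x < suc c) (ends (k , c)) → Vertical k
ends-within⇒Vertical hor₀ c (_ ∷ c<c ∷ []) = contradiction c<c (n≮n (suc c))
ends-within⇒Vertical hor₁ c (_ ∷ c<c ∷ []) = contradiction c<c (n≮n (suc c))
ends-within⇒Vertical hor₂ c (_ ∷ c<c ∷ []) = contradiction c<c (n≮n (suc c))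
ends-within⇒Vertical ver₀ c _               = inj₁ refl
ends-within⇒Vertical ver₁ c _               = inj₂ refl

module Occupancy {m} {M : List (Edge 3 m)} (edges : All IsEdge M) (separated : AllPairs Separated M)
  where

  slots : List Slot
  slots = map slot M

  occupied? : Decidable (_∈ slots)
  occupied? s = any? (s ≟ₛ_) slots

  content : ℕ → Pattern
  content c = filter (occupied? ∘ (_, c)) kinds

  occupied-content : ∀ {k c} → k ∈ content c → (k , c) ∈ slots
  occupied-content {c = c} k∈ = proj₂ (∈-filter⁻ (occupied? ∘ (_, c)) k∈)

  occupied-clash : ∀ {s t} → s ∈ slots → t ∈ slots → Clash s t → s ≡ t
  occupied-clash s∈ t∈ clash with ∈-map⁻ slot s∈ | ∈-map⁻ slot t∈
  ... | e , e∈M , refl | f , f∈M , refl with AllPairs-∈ Separated-sym separated e∈M f∈M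
  ... | inj₁ refl = refl
  ... | inj₂ e-f  =
    contradiction e-f (Clash⇒¬Separated (All.lookup edges e∈M) (All.lookup edges f∈M) clash)

  slots-unique : Unique slots
  slots-unique = AllPairs.map⁺ (AllPairs-mapᴬ slot-distinct edges separated)
    where
    slot-distinct : ∀ {e f} → IsEdge e → IsEdge f → Separated e f → slot e ≢ slot f
    slot-distinct isEdge-e isEdge-f e-f same =
      Clash⇒¬Separated isEdge-e isEdge-f (subst (Clash _) same (Clash-refl _)) e-f

  slots⊆grid : slots ⊆ concat (applyUpTo column m)
  slots⊆grid s∈ with ∈-map⁻ slot s∈
  ... | e , _ , refl =
    ∈-concat⁺′ (∈-map⁺ (_, proj₂ (slot e)) (∈-allFin _)) (∈-applyUpTo⁺ column (slot-column< e))

  length≤∑content : length M ≤ ∑< m (length ∘ content)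
  length≤∑content = begin
    length M
      ≡⟨ length-map slot M ⟨
    length slots
      ≤⟨ Unique-⊆⇒length≤ slots-unique (λ s∈ → ∈-filter⁺ occupied? (slots⊆grid s∈) s∈) ⟩
    length (filter occupied? (concat (applyUpTo column m)))
      ≡⟨ length-filter-concat occupied? column m ⟩
    ∑< m (length ∘ filter occupied? ∘ column)
      ≡⟨ ∑<-cong m (λ c → trans (cong length (filter-map occupied? (_, c) kinds))
                                   (length-map (_, c) (content c))) ⟩
    ∑< m (length ∘ content) ∎
    where open ≤-Reasoning

  content-consistent : ∀ d c → Consistent d (content c) (content (d + c))
  content-consistent d c = All.tabulate λ k∈ → All.tabulate λ l∈ clash →
    let same = occupied-clash (occupied-content k∈) (occupied-content l∈)
                              (Clash-shiftʳ c clash)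
    in +-cancelʳ-≡ c d 0 (sym (cong proj₂ same)) , cong proj₁ same

  content-feasible : ∀ c → content c ∈ feasible
  content-feasible c =
    ∈-filter⁺ (λ p → Consistent? 0 p p) (filter∈subsequences (occupied? ∘ (_, c)) kinds)
              (content-consistent 0 c)

  last-content-vertical : ∀ {c} → m ≡ suc c → All Vertical (content c)
  last-content-vertical {c} refl = All.tabulate λ {k} k∈ →
    ends-within⇒Vertical k c (ends-column< (occupied-content k∈))
    where
    ends-column< : ∀ {s} → s ∈ slots → All (λ x → proj₂ x < m) (ends s)
    ends-column< s∈ with ∈-map⁻ slot s∈
    ... | e , e∈M , refl = All.tabulate λ x∈ →
      All.lookup (points-column< e) (ends-slot⊆points (All.lookup edges e∈M) x∈)

potential-bound : ∀ {a b s φ₀ φₙ} n → 4 * s + φₙ ≤ n * 3 + φ₀ → 4 * (a + b) + φ₀ ≤ 6 → 2 ≤ φₙ →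
  4 * (a + (b + s)) + 1 < 3 * suc (suc n)
potential-bound {a} {b} {s} {φ₀} {φₙ} n middle first last = +-cancelʳ-≤ (φ₀ + φₙ) _ _ (begin
  suc (4 * (a + (b + s)) + 1) + (φ₀ + φₙ)
    ≡⟨ solve 6 (λ a b s φ₀ φₙ n → con 1 :+ (con 4 :* (a :+ (b :+ s)) :+ con 1) :+ (φ₀ :+ φₙ)
                := (con 4 :* (a :+ b) :+ φ₀) :+ (con 4 :* s :+ φₙ) :+ con 2) refl a b s φ₀ φₙ n ⟩
  (4 * (a + b) + φ₀) + (4 * s + φₙ) + 2
    ≤⟨ +-mono-≤ (+-mono-≤ first middle) last ⟩
  6 + (n * 3 + φ₀) + φₙ
    ≡⟨ solve 3 (λ φ₀ φₙ n → con 6 :+ (n :* con 3 :+ φ₀) :+ φₙ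
                := con 3 :* (con 2 :+ n) :+ (φ₀ :+ φₙ)) refl φ₀ φₙ n ⟩
  3 * suc (suc n) + (φ₀ + φₙ) ∎)
  where
  open ≤-Reasoning
  open +-*-Solver

upper-bound : ∀ {n} {M : List (Edge 3 (suc (suc n)))} → All IsEdge M → AllPairs Separated M →
  (ver₀ , 1) ∈ map slot M → 4 * length M + 1 < 3 * suc (suc n)
upper-bound {n} {M} edges separated ver₀∈ = begin-strict
  4 * length M + 1
    ≤⟨ +-monoˡ-≤ 1 (*-monoʳ-≤ 4 length≤∑content) ⟩
  4 * (W 0 + (W 1 + ∑< n (λ i → W (2 + i)))) + 1
    <⟨ potential-bound {W 0} {W 1} {∑< n (λ i → W (2 + i))} {Φ 0} {Φ n} n
         (telescope {4} {3} (λ i → W (2 + i)) Φ step n) first last ⟩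
  3 * suc (suc n) ∎
  where
  open ≤-Reasoning
  open Occupancy edges separated
  W : ℕ → ℕ
  W = length ∘ content
  Φ : ℕ → ℕ
  Φ i = potential (content i) (content (suc i))
  step : ∀ i → 4 * W (suc (suc i)) + Φ (suc i) ≤ 3 + Φ i
  step i = potential-step (content-feasible i) (content-feasible (1 + i)) (content-feasible (2 + i))
    (content-consistent 1 i) (content-consistent 1 (1 + i)) (content-consistent 2 i)
  first : 4 * (W 0 + W 1) + Φ 0 ≤ 6
  first = potential-start (content-feasible 0) (content-feasible 1)
    (∈-filter⁺ (occupied? ∘ (_, 1)) (∈-allFin ver₀) ver₀∈) (content-consistent 1 0)
  last : 2 ≤ Φ n
  last = potential-end (content-feasible n) (content-feasible (suc n))
    (last-content-vertical refl) (content-consistent 1 n)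

-- The lower bound

shiftᵥ : ∀ {n} → Vertex 3 n → Vertex 3 (4 + n)
shiftᵥ (i , j) = i , 4 ↑ʳ j

shiftₑ : ∀ {n} → Edge 3 n → Edge 3 (4 + n)
shiftₑ (u , v) = shiftᵥ u , shiftᵥ v

shiftᵥ-injective : ∀ {n} {u v : Vertex 3 n} → shiftᵥ u ≡ shiftᵥ v → u ≡ v
shiftᵥ-injective {u = _ , j} {_ , l} eq =
  cong₂ _,_ (cong proj₁ eq) (↑ʳ-injective 4 j l (cong proj₂ eq))

GridAdj-shift : ∀ {n} {u v : Vertex 3 n} → GridAdj u v → GridAdj (shiftᵥ u) (shiftᵥ v)
GridAdj-shift (inj₁ (p , q)) = inj₁ (p , Sum.map (cong (4 +_)) (cong (4 +_)) q)
GridAdj-shift (inj₂ (p , q)) = inj₂ (cong (4 ↑ʳ_) p , q)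

GridAdj-unshift : ∀ {n} {u v : Vertex 3 n} → GridAdj (shiftᵥ u) (shiftᵥ v) → GridAdj u v
GridAdj-unshift (inj₁ (p , q)) = inj₁ (p , Sum.map (+-cancelˡ-≡ 4 _ _) (+-cancelˡ-≡ 4 _ _) q)
GridAdj-unshift {u = _ , j} {_ , l} (inj₂ (p , q)) = inj₂ (↑ʳ-injective 4 j l p , q)

Separated-shift : ∀ {n} {e f : Edge 3 n} → Separated e f → Separated (shiftₑ e) (shiftₑ f)
Separated-shift (¬touch , ¬joined) =
  ¬touch ∘ Sum.map (Sum.map shiftᵥ-injective shiftᵥ-injective)
                   (Sum.map shiftᵥ-injective shiftᵥ-injective) ,
  ¬joined ∘ Sum.map (Sum.map GridAdj-unshift GridAdj-unshift)
                    (Sum.map GridAdj-unshift GridAdj-unshift)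

u₂v₁ : ∀ {n} → Vertex 3 (suc n)
u₂v₁ = 1F , 0F

-- A block meets the shifted copy that follows it only through the edge between u₂v₄ and
-- u₂v₅ = shiftᵥ u₂v₁, so it suffices that the copy avoids u₂v₁.
Guarded : ∀ {n} → Vertex 3 (5 + n) → Set
Guarded u = ∀ v → u ≢ shiftᵥ v × (GridAdj u (shiftᵥ v) → v ≡ u₂v₁)

guarded-left : ∀ {n} r (c : Fin 3) → Guarded {n} (r , c ↑ˡ (2 + n))
guarded-left r 0F v = (λ ()) , λ { (inj₁ (_ , inj₁ ())) ; (inj₁ (_ , inj₂ ())) ; (inj₂ (() , _)) }
guarded-left r 1F v = (λ ()) , λ { (inj₁ (_ , inj₁ ())) ; (inj₁ (_ , inj₂ ())) ; (inj₂ (() , _)) }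
guarded-left r 2F v = (λ ()) , λ { (inj₁ (_ , inj₁ ())) ; (inj₁ (_ , inj₂ ())) ; (inj₂ (() , _)) }

guarded-u₂v₄ : ∀ {n} → Guarded {n} (1F , 3F)
guarded-u₂v₄ (i , j) = (λ ()) , λ
  { (inj₁ (refl , inj₁ q)) → cong (1F ,_) (sym (toℕ-injective {i = 0F} (+-cancelˡ-≡ 4 0 _ q)))
  ; (inj₁ (_ , inj₂ ()))
  ; (inj₂ (() , _))
  }

Separated-from-shift : ∀ {n} {u v : Vertex 3 (5 + n)} {f : Edge 3 (suc n)} →
  Guarded u → Guarded v → ¬ u₂v₁ ∈ₑ f → Separated (u , v) (shiftₑ f)
Separated-from-shift gu gv u₂v₁∉f = ¬touch , ¬joined
  where
  ¬touch : ¬ Touch _ _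
  ¬touch (inj₁ (inj₁ eq)) = proj₁ (gu _) eq
  ¬touch (inj₁ (inj₂ eq)) = proj₁ (gu _) eq
  ¬touch (inj₂ (inj₁ eq)) = proj₁ (gv _) eq
  ¬touch (inj₂ (inj₂ eq)) = proj₁ (gv _) eq
  ¬joined : ¬ Joined _ _
  ¬joined (inj₁ (inj₁ adj)) = u₂v₁∉f (inj₁ (sym (proj₂ (gu _) adj)))
  ¬joined (inj₁ (inj₂ adj)) = u₂v₁∉f (inj₂ (sym (proj₂ (gu _) adj)))
  ¬joined (inj₂ (inj₁ adj)) = u₂v₁∉f (inj₁ (sym (proj₂ (gv _) adj)))
  ¬joined (inj₂ (inj₂ adj)) = u₂v₁∉f (inj₂ (sym (proj₂ (gv _) adj)))

hor : ∀ {n} → Fin 3 → Fin n → Edge 3 (suc n)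
hor r c = (r , inject₁ c) , (r , suc c)

block : ∀ {n} → List (Edge 3 (4 + n))
block = hor 0F 0F ∷ hor 2F 0F ∷ hor 1F 2F ∷ []

blockMatching : ∀ k → List (Edge 3 (3 + k))
blockMatching 0 = hor 0F 0F ∷ hor 2F 0F ∷ []
blockMatching 1 = hor 0F 0F ∷ hor 2F 0F ∷ hor 1F 2F ∷ []
blockMatching 2 = hor 0F 0F ∷ hor 2F 0F ∷ hor 0F 3F ∷ hor 2F 3F ∷ []
blockMatching 3 = hor 0F 0F ∷ hor 2F 0F ∷ hor 1F 2F ∷ hor 0F 4F ∷ hor 2F 4F ∷ []
blockMatching (suc (suc (suc (suc k)))) = block ++ map shiftₑ (blockMatching k)

InducedAvoidingU₂V₁ : ∀ {n} → List (Edge 3 (suc n)) → Set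
InducedAvoidingU₂V₁ L = All IsEdge L × AllPairs Separated L × All (λ e → ¬ u₂v₁ ∈ₑ e) L

InducedAvoidingU₂V₁? : ∀ {n} (L : List (Edge 3 (suc n))) → Dec (InducedAvoidingU₂V₁ L)
InducedAvoidingU₂V₁? L =
  all? (λ e → GridAdj? (proj₁ e) (proj₂ e)) L ×-dec allPairs? Separated? L ×-dec
  all? (λ e → ¬? ((u₂v₁ ≟ᵥ proj₁ e) ⊎-dec (u₂v₁ ≟ᵥ proj₂ e))) L

blockMatching-induced : ∀ k → InducedAvoidingU₂V₁ (blockMatching k)
blockMatching-induced 0 = toWitness {a? = InducedAvoidingU₂V₁? (blockMatching 0)} tt
blockMatching-induced 1 = toWitness {a? = InducedAvoidingU₂V₁? (blockMatching 1)} tt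
blockMatching-induced 2 = toWitness {a? = InducedAvoidingU₂V₁? (blockMatching 2)} tt
blockMatching-induced 3 = toWitness {a? = InducedAvoidingU₂V₁? (blockMatching 3)} tt
blockMatching-induced (suc (suc (suc (suc k))))
  with blockMatching-induced k | toWitness {a? = InducedAvoidingU₂V₁? (block {3 + k})} tt
... | edges , separated , avoids | block-edges , block-separated , block-avoids =
  All.++⁺ block-edges (All.map⁺ (All.map GridAdj-shift edges)) ,
  AllPairs.++⁺ block-separated (AllPairs.map⁺ (AllPairs.map Separated-shift separated)) cross ,
  All.++⁺ block-avoids (All.map⁺ (All.universal (λ _ → λ { (inj₁ ()) ; (inj₂ ()) }) _))
  where
  cross : All (λ e → All (Separated e) (map shiftₑ (blockMatching k))) block
  cross = from-guarded (guarded-left 0F 0F) (guarded-left 0F 1F) ∷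
          from-guarded (guarded-left 2F 0F) (guarded-left 2F 1F) ∷
          from-guarded (guarded-left 1F 2F) guarded-u₂v₄ ∷ []
    where
    from-guarded : ∀ {u v} → Guarded u → Guarded v →
      All (Separated (u , v)) (map shiftₑ (blockMatching k))
    from-guarded gu gv = All.map⁺ (All.map (Separated-from-shift gu gv) avoids)

blockMatching-size : ∀ k → 3 * (3 + k) ≤ 4 * length (blockMatching k) + 1
blockMatching-size 0 = ≤ᵇ⇒≤ 9 9 tt
blockMatching-size 1 = ≤ᵇ⇒≤ 12 13 tt
blockMatching-size 2 = ≤ᵇ⇒≤ 15 17 tt
blockMatching-size 3 = ≤ᵇ⇒≤ 18 21 tt
blockMatching-size (suc (suc (suc (suc k)))) = begin
  3 * (4 + (3 + k))
    ≡⟨ *-distribˡ-+ 3 4 (3 + k) ⟩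
  12 + 3 * (3 + k)
    ≤⟨ +-monoʳ-≤ 12 (blockMatching-size k) ⟩
  12 + (4 * length (blockMatching k) + 1)
    ≡⟨ cong (λ l → 12 + (4 * l + 1)) (length-map shiftₑ (blockMatching k)) ⟨
  12 + (4 * length shifted + 1)
    ≡⟨ trans (cong (_+ 1) (*-distribˡ-+ 4 3 (length shifted))) (+-assoc 12 _ 1) ⟨
  4 * (3 + length shifted) + 1 ∎
  where
  open ≤-Reasoning
  shifted : List (Edge 3 (7 + k))
  shifted = map shiftₑ (blockMatching k)

lemma3p2 : (k : ℕ) → let m = suc (suc (suc k)) in
    (M : List (Edge 3 m)) → IsInducedMatching 3 m M →
    ContainsEdge M u1v2 u2v2 →
    ¬ IsMaximumInducedMatching 3 m M
lemma3p2 k M induced contains (_ , maximum) with induced⇒AllPairs induced | blockMatching-induced k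
... | edges , separated | block-edges , block-separated , _ = <-irrefl refl (begin-strict
  4 * length M + 1
    <⟨ upper-bound edges separated (Sum.[ ∈-map⁺ slot , ∈-map⁺ slot ]′ contains) ⟩
  3 * (3 + k)
    ≤⟨ blockMatching-size k ⟩
  4 * length (blockMatching k) + 1
    ≤⟨ +-monoˡ-≤ 1 (*-monoʳ-≤ 4 (maximum (blockMatching k) block-induced)) ⟩
  4 * length M + 1 ∎)
  where
  open ≤-Reasoning
  block-induced : IsInducedMatching 3 (3 + k) (blockMatching k)
  block-induced = AllPairs⇒induced block-edges block-separated
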